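{- Let $u\neq v$ be cyclic binary words of length $n$ with $n_{0,u}=n_{0,v}=n_0$, $n_{1,u}=n_{1,v}=n_1$, $l_u=l_v$, and $n_0\ge n_1$. If $x_u\neq x_v$, then $u$ and $v$ have a distinguishing subword of length at most $\frac34 n+4$.
   Context: The alphabet is $\{0,1\}$. A cyclic word is an equivalence class of finite words under conjugacy. If a cyclic word $w$ has representative $w_1\cdots w_n$, a subword of $w$ is any cyclic word with a representative $w_{i_1}\cdots w_{i_k}$, $1\le i_1<\dots<i_k\le n$. A distinguishing subword for $u,v$ is a cyclic word which is a subword of exactly one of them. $n_{0,w},n_{1,w}$ are the numbers of 0's and 1's in $w$; a block of 0's is a maximal cyclic run of 0's bounded by 1's; $l_w$ is the number of blocks of 0's; $x_w$ is the length of the longest block of 0's in $w$. -}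

module Defs where

open import Data.Nat using (ℕ; zero; suc; _⊔_)
open import Data.List using (List; []; _∷_; _++_; drop; take; length; map; foldr; upTo; zip)
open import Data.Product using (_×_; _,_; ∃)
open import Data.Sum using (_⊎_)
open import Relation.Nullary using (¬_)
open import Relation.Binary.PropositionalEquality using (_≡_)
open import Data.List.Relation.Binary.Sublist.Propositional using (_⊆_)

data Bit : Set where
  b0 b1 : Bit

-- A word is a list of bits; a cyclic word is represented by any of its
-- representatives, conjugacy = rotation.
Word : Set
Word = List Bit

-- rotate k w = w_{k+1} ... w_n w_1 ... w_k   (identity when k ≥ length w)
rotate : ℕ → Word → Word
rotate k w = drop k w ++ take k w

Conj : Word → Word → Set
Conj u v = ∃ λ k → rotate k u ≡ v

-- s is a subword of the cyclic word w: some representative of s is a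
-- (scattered) subsequence of some representative of w.
IsSubword : Word → Word → Set
IsSubword s w = ∃ λ j → ∃ λ k → rotate j s ⊆ rotate k w

Distinguishing : Word → Word → Word → Set
Distinguishing s u v = (IsSubword s u × ¬ IsSubword s v) ⊎ (IsSubword s v × ¬ IsSubword s u)

count : Bit → Word → ℕ
count b [] = 0
count b0 (b0 ∷ w) = suc (count b0 w)
count b1 (b1 ∷ w) = suc (count b1 w)
count b0 (b1 ∷ w) = count b0 w
count b1 (b0 ∷ w) = count b1 w

n0 : Word → ℕ
n0 = count b0

n1 : Word → ℕ
n1 = count b1

count01 : List (Bit × Bit) → ℕ
count01 [] = 0
count01 ((b0 , b1) ∷ ps) = suc (count01 ps)
count01 (_ ∷ ps) = count01 ps

-- l_w: number of blocks of 0's = number of cyclic 0→1 transitions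
-- (each maximal cyclic run of 0's bounded by 1's ends at exactly one such
-- transition).
blocks0 : Word → ℕ
blocks0 w = count01 (zip w (rotate 1 w))

lead0 : Word → ℕ
lead0 (b0 ∷ w) = suc (lead0 w)
lead0 _ = 0

maxList : List ℕ → ℕ
maxList = foldr _⊔_ 0

-- x_w: length of the longest block of 0's = maximum over all rotations of
-- the number of leading 0's (a block of 0's is a maximal cyclic run).
longest0 : Word → ℕ
longest0 w = maxList (map (λ k → lead0 (rotate k w)) (upTo (length w)))

-- Assume x_v < x_u and put y = x_v.  A cyclic word w with n_1 ones contains
-- 0^(y+1) 1^(n_1) exactly when y < x_w, so this word lies in u but not in v.
-- With q = n_0 + 1 - x_u, the word 0^q 1 0^q 1 is not a subword of u: its two
-- 1's would cut the 0's of u into two arcs of at least q zeros each, leaving at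
-- most n_0 - q < x_u zeros for a longest block.  It is a subword of v when
-- q ≤ y: the first 0^q fits into a longest block of v, the second into the
-- remaining n_0 - y ≥ q zeros.  Using n_1 ≤ n_0, one of the two words is short
-- enough: if the first is too long then y is large, which forces q ≤ y and
-- makes 2q + 2 small.
module Submission where

open import Defs
open import Data.Nat using (ℕ; zero; suc; _*_; _+_; _≤_; _≥_; _<_; _∸_; z≤n; s≤s; _≤?_)
open import Data.Nat.Properties
open import Data.Nat.Tactic.RingSolver using (solve)
open import Data.List using (List; []; _∷_; _++_; length; replicate; take; drop; map; upTo; initLast; _∷ʳ′_)
open import Data.List.Properties using (++-assoc; ++-identityʳ; take++drop≡id; take-all; drop-all; length-++; length-++-≤ˡ; length-replicate; ∷-injective; foldr-preservesᵒ)
open import Data.List.Membership.Propositional using (_∈_)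
open import Data.List.Membership.Propositional.Properties using (∈-map⁺; ∈-map⁻; ∈-upTo⁺; foldr-selective)
open import Data.List.Relation.Unary.Any as Any using ()
open import Data.List.Relation.Binary.Sublist.Propositional using (_⊆_; []; _∷ʳ_; _∷_; ⊆-refl; ⊆-trans)
open import Data.List.Relation.Binary.Sublist.Propositional.Properties using (++⁺; length-mono-≤)
open import Data.Product using (_×_; _,_; ∃; ∃₂; map₁; map₂)
open import Data.Sum using (_⊎_; inj₁; inj₂; [_,_]; [_,_]′; swap)
open import Data.Empty using (⊥-elim)
open import Function using (_∘_)
open import Relation.Nullary using (¬_; Dec; yes; no)
open import Relation.Binary using (Tri; tri<; tri≈; tri>)
open import Relation.Binary.PropositionalEquality using (_≡_; _≢_; refl; sym; trans; cong; cong₂; subst; subst₂; module ≡-Reasoning)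

private
  variable
    A : Set

++-align : ∀ (a b c d : List A) → a ++ b ≡ c ++ d →
           (∃ λ e → c ≡ a ++ e × b ≡ e ++ d) ⊎ (∃ λ e → a ≡ c ++ e × d ≡ e ++ b)
++-align [] b c d eq = inj₁ (c , refl , eq)
++-align (x ∷ a) b [] d eq = inj₂ (x ∷ a , refl , sym eq)
++-align (x ∷ a) b (y ∷ c) d eq with ∷-injective eq
... | refl , eq′ with ++-align a b c d eq′
... | inj₁ (e , c≡ , b≡) = inj₁ (e , cong (x ∷_) c≡ , b≡)
... | inj₂ (e , a≡ , d≡) = inj₂ (e , cong (x ∷_) a≡ , d≡)

take-length-++ : ∀ (a b : List A) → take (length a) (a ++ b) ≡ a
take-length-++ [] b = refl
take-length-++ (x ∷ a) b = cong (x ∷_) (take-length-++ a b)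

drop-length-++ : ∀ (a b : List A) → drop (length a) (a ++ b) ≡ b
drop-length-++ [] b = refl
drop-length-++ (x ∷ a) b = drop-length-++ a b

++-⊆-split : ∀ (a b : List A) {t} → a ++ b ⊆ t →
             ∃₂ λ t₁ t₂ → t ≡ t₁ ++ t₂ × a ⊆ t₁ × b ⊆ t₂
++-⊆-split [] b {t} b⊆t = [] , t , refl , [] , b⊆t
++-⊆-split (x ∷ a) b (y ∷ʳ p) with ++-⊆-split (x ∷ a) b p
... | t₁ , t₂ , refl , p₁ , p₂ = y ∷ t₁ , t₂ , refl , y ∷ʳ p₁ , p₂
++-⊆-split (x ∷ a) b (refl ∷ p) with ++-⊆-split a b p
... | t₁ , t₂ , refl , p₁ , p₂ = x ∷ t₁ , t₂ , refl , refl ∷ p₁ , p₂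

∷-⊆-split : ∀ (x : A) (b : List A) {t} → x ∷ b ⊆ t →
            ∃₂ λ t₁ t₂ → t ≡ t₁ ++ x ∷ t₂ × b ⊆ t₂
∷-⊆-split x b (y ∷ʳ p) with ∷-⊆-split x b p
... | t₁ , t₂ , refl , p′ = y ∷ t₁ , t₂ , refl , p′
∷-⊆-split x b {_ ∷ t} (refl ∷ p) = [] , t , refl , p

replicate-⊆ : ∀ (x : A) {m k} → m ≤ k → replicate m x ⊆ replicate k x
replicate-⊆ x {k = zero} z≤n = []
replicate-⊆ x {k = suc k} z≤n = x ∷ʳ replicate-⊆ x z≤n
replicate-⊆ x (s≤s m≤k) = refl ∷ replicate-⊆ x m≤k

∈⇒≤maxList : ∀ {x xs} → x ∈ xs → x ≤ maxList xs
∈⇒≤maxList {x} {xs} x∈xs =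
  foldr-preservesᵒ {P = x ≤_} (λ m n → [ m≤n⇒m≤n⊔o n , m≤n⇒m≤o⊔n m ]) 0 xs
    (inj₂ (Any.map ≤-reflexive x∈xs))

-- Conjugacy and subwords

infix 4 _∼_
_∼_ : List A → List A → Set
w ∼ t = ∃₂ λ a b → w ≡ a ++ b × t ≡ b ++ a

∼-refl : ∀ (w : List A) → w ∼ w
∼-refl w = [] , w , refl , sym (++-identityʳ w)

∼-sym : ∀ {w t : List A} → w ∼ t → t ∼ w
∼-sym (a , b , w≡ , t≡) = b , a , t≡ , w≡

∼-trans : ∀ {w t z : List A} → w ∼ t → t ∼ z → w ∼ z
∼-trans (a , b , refl , refl) (c , d , eq , refl) with ++-align b a c d eq
... | inj₁ (e , refl , refl) = e , d ++ b , ++-assoc e d b , sym (++-assoc d b e)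
... | inj₂ (e , refl , refl) = a ++ c , e , sym (++-assoc a c e) , ++-assoc e a c

rotate-∼ : ∀ k w → w ∼ rotate k w
rotate-∼ k w = take k w , drop k w , sym (take++drop≡id k w) , refl

∼⇒rotate : ∀ {w t} → w ∼ t → ∃ λ k → k ≤ length w × rotate k w ≡ t
∼⇒rotate (a , b , refl , refl) =
  length a , length-++-≤ˡ a , cong₂ _++_ (drop-length-++ a b) (take-length-++ a b)

IsSubword⇒⊆∼ : ∀ {s w} → IsSubword s w → ∃ λ t → w ∼ t × s ⊆ t
IsSubword⇒⊆∼ {s} {w} (j , k , p) with ++-⊆-split (drop j s) (take j s) p
... | t₁ , t₂ , rotw≡ , p₁ , p₂ =
  t₂ ++ t₁ , ∼-trans (rotate-∼ k w) (t₁ , t₂ , rotw≡ , refl) ,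
  subst (_⊆ t₂ ++ t₁) (take++drop≡id j s) (++⁺ p₂ p₁)

⊆∼⇒IsSubword : ∀ {s w t} → w ∼ t → s ⊆ t → IsSubword s w
⊆∼⇒IsSubword {s} w∼t p with ∼⇒rotate w∼t
... | k , _ , rot≡t = 0 , k , subst₂ _⊆_ (sym (++-identityʳ s)) (sym rot≡t) p

count-++ : ∀ b (x y : Word) → count b (x ++ y) ≡ count b x + count b y
count-++ b [] y = refl
count-++ b0 (b0 ∷ x) y = cong suc (count-++ b0 x y)
count-++ b0 (b1 ∷ x) y = count-++ b0 x y
count-++ b1 (b0 ∷ x) y = count-++ b1 x y
count-++ b1 (b1 ∷ x) y = cong suc (count-++ b1 x y)

count-replicate : ∀ b m → count b (replicate m b) ≡ m
count-replicate b zero = refl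
count-replicate b0 (suc m) = cong suc (count-replicate b0 m)
count-replicate b1 (suc m) = cong suc (count-replicate b1 m)

count-b1-zeros : ∀ m → count b1 (replicate m b0) ≡ 0
count-b1-zeros zero = refl
count-b1-zeros (suc m) = count-b1-zeros m

count-≤-∷ : ∀ b c w → count b w ≤ count b (c ∷ w)
count-≤-∷ b0 b0 w = n≤1+n _
count-≤-∷ b0 b1 w = ≤-refl
count-≤-∷ b1 b0 w = ≤-refl
count-≤-∷ b1 b1 w = n≤1+n _

count-∷-mono : ∀ b c {w t} → count b w ≤ count b t → count b (c ∷ w) ≤ count b (c ∷ t)
count-∷-mono b0 b0 le = s≤s le
count-∷-mono b0 b1 le = le
count-∷-mono b1 b0 le = le
count-∷-mono b1 b1 le = s≤s le

count-mono-⊆ : ∀ b {a t} → a ⊆ t → count b a ≤ count b t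
count-mono-⊆ b [] = z≤n
count-mono-⊆ b (y ∷ʳ p) = ≤-trans (count-mono-⊆ b p) (count-≤-∷ b y _)
count-mono-⊆ b (refl ∷ p) = count-∷-mono b _ (count-mono-⊆ b p)

count-suffix-≤ : ∀ b (p e : Word) → count b e ≤ count b (p ++ e)
count-suffix-≤ b p e = subst (count b e ≤_) (sym (count-++ b p e)) (m≤n+m _ _)

replicate-count-⊆ : ∀ b (w : Word) → replicate (count b w) b ⊆ w
replicate-count-⊆ b [] = []
replicate-count-⊆ b0 (b0 ∷ w) = refl ∷ replicate-count-⊆ b0 w
replicate-count-⊆ b0 (b1 ∷ w) = b1 ∷ʳ replicate-count-⊆ b0 w
replicate-count-⊆ b1 (b0 ∷ w) = b0 ∷ʳ replicate-count-⊆ b1 w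
replicate-count-⊆ b1 (b1 ∷ w) = refl ∷ replicate-count-⊆ b1 w

∼-count : ∀ b {w t} → w ∼ t → count b w ≡ count b t
∼-count b (a , c , refl , refl) =
  trans (count-++ b a c) (trans (+-comm (count b a) (count b c)) (sym (count-++ b c a)))

length≡n0+n1 : ∀ w → length w ≡ n0 w + n1 w
length≡n0+n1 [] = refl
length≡n0+n1 (b0 ∷ w) = cong suc (length≡n0+n1 w)
length≡n0+n1 (b1 ∷ w) = trans (cong suc (length≡n0+n1 w)) (sym (+-suc _ _))

-- Blocks of zeros

lead0-split : ∀ t → ∃ λ r → t ≡ replicate (lead0 t) b0 ++ r × lead0 r ≡ 0
lead0-split [] = [] , refl , refl
lead0-split (b1 ∷ t) = b1 ∷ t , refl , refl
lead0-split (b0 ∷ t) with lead0-split t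
... | r , t≡ , r₀ = r , cong (b0 ∷_) t≡ , r₀

lead0-zeros-one : ∀ m r → lead0 (replicate m b0 ++ b1 ∷ r) ≡ m
lead0-zeros-one zero r = refl
lead0-zeros-one (suc m) r = cong suc (lead0-zeros-one m r)

lead0-≤-count-before-one : ∀ e r → lead0 (e ++ b1 ∷ r) ≤ count b0 e
lead0-≤-count-before-one [] r = z≤n
lead0-≤-count-before-one (b0 ∷ e) r = s≤s (lead0-≤-count-before-one e r)
lead0-≤-count-before-one (b1 ∷ e) r = z≤n

length-≤-lead0 : ∀ (a b : Word) → count b1 a ≡ 0 → length a ≤ lead0 (a ++ b)
length-≤-lead0 [] b _ = z≤n
length-≤-lead0 (b0 ∷ a) b no1 = s≤s (length-≤-lead0 a b no1)
length-≤-lead0 (b1 ∷ a) b ()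

lead0-≤-n0 : ∀ w → lead0 w ≤ n0 w
lead0-≤-n0 [] = z≤n
lead0-≤-n0 (b0 ∷ w) = s≤s (lead0-≤-n0 w)
lead0-≤-n0 (b1 ∷ w) = z≤n

rotation-lead0s : Word → List ℕ
rotation-lead0s w = map (λ k → lead0 (rotate k w)) (upTo (length w))

lead0-rotate-≤-longest0 : ∀ w k → k < length w → lead0 (rotate k w) ≤ longest0 w
lead0-rotate-≤-longest0 w k k<|w| =
  ∈⇒≤maxList (∈-map⁺ (λ k → lead0 (rotate k w)) (∈-upTo⁺ k<|w|))

lead0-≤-longest0 : ∀ w → lead0 w ≤ longest0 w
lead0-≤-longest0 [] = z≤n
lead0-≤-longest0 w@(_ ∷ _) =
  subst (λ t → lead0 t ≤ longest0 w) (++-identityʳ w) (lead0-rotate-≤-longest0 w 0 (s≤s z≤n))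

lead0-∼-≤-longest0 : ∀ {w t} → w ∼ t → lead0 t ≤ longest0 w
lead0-∼-≤-longest0 {w} w∼t with ∼⇒rotate w∼t
... | k , k≤|w| , refl with m≤n⇒m<n∨m≡n k≤|w|
... | inj₁ k<|w| = lead0-rotate-≤-longest0 w k k<|w|
... | inj₂ refl = subst (λ t → lead0 t ≤ longest0 w) (sym rotate-length) (lead0-≤-longest0 w)
  where
  rotate-length : rotate (length w) w ≡ w
  rotate-length = cong₂ _++_ (drop-all (length w) w ≤-refl) (take-all (length w) w ≤-refl)

longest0-witness : ∀ {m} w → m ≤ longest0 w → ∃ λ t → w ∼ t × m ≤ lead0 t
longest0-witness {zero} w _ = w , ∼-refl w , z≤n
longest0-witness {suc m} w m<x with foldr-selective ⊔-sel 0 (rotation-lead0s w)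
... | inj₁ x≡0 = ⊥-elim (<⇒≢ (≤-trans (s≤s z≤n) m<x) (sym x≡0))
... | inj₂ x∈ with ∈-map⁻ (λ k → lead0 (rotate k w)) x∈
... | k , _ , x≡ = rotate k w , rotate-∼ k w , subst (suc m ≤_) x≡ m<x

longest0-≤-n0 : ∀ w → longest0 w ≤ n0 w
longest0-≤-n0 w with longest0-witness w ≤-refl
... | t , w∼t , x≤ = ≤-trans x≤ (subst (lead0 t ≤_) (sym (∼-count b0 w∼t)) (lead0-≤-n0 t))

longest-block-rotation : ∀ w → longest0 w < n0 w →
                         ∃ λ p → w ∼ replicate (longest0 w) b0 ++ b1 ∷ p ++ b1 ∷ []
longest-block-rotation w x<n0 with longest0-witness w ≤-refl
... | t , w∼t , x≤ with lead0-split t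
... | r , t≡ , r₀ = rest r t≡ r₀
  where
  x≡ : lead0 t ≡ longest0 w
  x≡ = ≤-antisym (lead0-∼-≤-longest0 w∼t) x≤
  n0≡ : ∀ {r} → t ≡ replicate (lead0 t) b0 ++ r → n0 w ≡ longest0 w + n0 r
  n0≡ {r} t≡ = begin
    n0 w                               ≡⟨ ∼-count b0 w∼t ⟩
    n0 t                               ≡⟨ cong n0 t≡ ⟩
    n0 (replicate (lead0 t) b0 ++ r)   ≡⟨ count-++ b0 (replicate (lead0 t) b0) r ⟩
    n0 (replicate (lead0 t) b0) + n0 r ≡⟨ cong (_+ n0 r) (trans (count-replicate b0 _) x≡) ⟩
    longest0 w + n0 r                  ∎
    where open ≡-Reasoning
  no-zeros-after : ∀ {r} → t ≡ replicate (lead0 t) b0 ++ r → n0 r ≢ 0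
  no-zeros-after t≡ n0r≡0 =
    <-irrefl (sym (trans (n0≡ t≡) (trans (cong (longest0 w +_) n0r≡0) (+-identityʳ _)))) x<n0
  rest : ∀ r → t ≡ replicate (lead0 t) b0 ++ r → lead0 r ≡ 0 →
         ∃ λ p → w ∼ replicate (longest0 w) b0 ++ b1 ∷ p ++ b1 ∷ []
  rest [] t≡ _ = ⊥-elim (no-zeros-after t≡ refl)
  rest (b0 ∷ _) _ ()
  rest (b1 ∷ r′) t≡ _ with initLast r′
  ... | [] = ⊥-elim (no-zeros-after t≡ refl)
  ... | p ∷ʳ′ b1 =
    p , subst (λ m → w ∼ replicate m b0 ++ b1 ∷ p ++ b1 ∷ []) x≡ (subst (w ∼_) t≡ w∼t)
  -- a final 0 would extend the longest block cyclically
  ... | p ∷ʳ′ b0 = ⊥-elim (<-irrefl refl (begin-strict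
      longest0 w                                    ≡⟨ sym x≡ ⟩
      lead0 t                                       <⟨ n<1+n _ ⟩
      suc (lead0 t)                                 ≡⟨ sym (cong suc (lead0-zeros-one (lead0 t) p)) ⟩
      lead0 (b0 ∷ replicate (lead0 t) b0 ++ b1 ∷ p)
        ≤⟨ lead0-∼-≤-longest0 (∼-trans w∼t last-zero-first) ⟩
      longest0 w                                    ∎))
    where
    open ≤-Reasoning
    last-zero-first : t ∼ b0 ∷ replicate (lead0 t) b0 ++ b1 ∷ p
    last-zero-first = replicate (lead0 t) b0 ++ b1 ∷ p , b0 ∷ [] ,
      trans t≡ (sym (++-assoc (replicate (lead0 t) b0) (b1 ∷ p) (b0 ∷ []))) , refl

lead0-∼-two-ones : ∀ Y X {z} → b1 ∷ Y ++ b1 ∷ X ∼ z →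
                   lead0 z ≤ count b0 Y ⊎ lead0 z ≤ count b0 X
lead0-∼-two-ones Y X (a , b , eq , refl) with ++-align a b (b1 ∷ Y) (b1 ∷ X) (sym eq)
... | inj₁ (e , Y≡ , refl) = inj₁ (begin
  lead0 ((e ++ b1 ∷ X) ++ a)   ≡⟨ cong lead0 (++-assoc e (b1 ∷ X) a) ⟩
  lead0 (e ++ b1 ∷ X ++ a)     ≤⟨ lead0-≤-count-before-one e (X ++ a) ⟩
  count b0 e                   ≤⟨ count-suffix-≤ b0 a e ⟩
  count b0 (a ++ e)            ≡⟨ cong (count b0) (sym Y≡) ⟩
  count b0 Y                   ∎)
  where open ≤-Reasoning
... | inj₂ ([] , refl , refl) = inj₂ z≤n
... | inj₂ (b0 ∷ e , _ , ())
... | inj₂ (b1 ∷ e , refl , X≡) with ∷-injective X≡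
... | _ , refl = inj₂ (≤-trans (lead0-≤-count-before-one b (Y ++ b1 ∷ e)) (count-suffix-≤ b0 e b))

∼-two-cuts : ∀ (P₁ Q₁ P₂ Q₂ : List A) x y →
             (P₁ ++ x ∷ Q₁) ++ (P₂ ++ y ∷ Q₂) ∼ x ∷ (Q₁ ++ P₂) ++ y ∷ (Q₂ ++ P₁)
∼-two-cuts P₁ Q₁ P₂ Q₂ x y =
  P₁ , x ∷ Q₁ ++ P₂ ++ y ∷ Q₂ , ++-assoc P₁ (x ∷ Q₁) _ , cong (x ∷_) (begin
  (Q₁ ++ P₂) ++ y ∷ Q₂ ++ P₁   ≡⟨ ++-assoc Q₁ P₂ _ ⟩
  Q₁ ++ P₂ ++ y ∷ Q₂ ++ P₁     ≡⟨ cong (Q₁ ++_) (sym (++-assoc P₂ (y ∷ Q₂) P₁)) ⟩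
  Q₁ ++ (P₂ ++ y ∷ Q₂) ++ P₁   ≡⟨ sym (++-assoc Q₁ _ P₁) ⟩
  (Q₁ ++ P₂ ++ y ∷ Q₂) ++ P₁   ∎)
  where open ≡-Reasoning

-- Distinguishing words

zerosOnes : ℕ → ℕ → Word
zerosOnes m k = replicate m b0 ++ replicate k b1

zerosOne : ℕ → Word
zerosOne q = replicate q b0 ++ b1 ∷ []

twoBlocks : ℕ → Word
twoBlocks q = zerosOne q ++ zerosOne q

length-zerosOnes : ∀ m k → length (zerosOnes m k) ≡ m + k
length-zerosOnes m k =
  trans (length-++ (replicate m b0)) (cong₂ _+_ (length-replicate m) (length-replicate k))

length-twoBlocks : ∀ q → length (twoBlocks q) ≡ 2 * (q + 1)
length-twoBlocks q = begin
  length (zerosOne q ++ zerosOne q)             ≡⟨ length-++ (zerosOne q) ⟩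
  length (zerosOne q) + length (zerosOne q)     ≡⟨ cong₂ _+_ length-zerosOne length-zerosOne ⟩
  (q + 1) + (q + 1)                             ≡⟨ solve (q ∷ []) ⟩
  2 * (q + 1)                                   ∎
  where
  open ≡-Reasoning
  length-zerosOne : length (zerosOne q) ≡ q + 1
  length-zerosOne = trans (length-++ (replicate q b0)) (cong (_+ 1) (length-replicate q))

zerosOnes-subword : ∀ {m} w → m ≤ longest0 w → IsSubword (zerosOnes m (n1 w)) w
zerosOnes-subword {m} w m≤x with longest0-witness w m≤x
... | t , w∼t , m≤lead with lead0-split t
... | r , t≡ , _ = ⊆∼⇒IsSubword w∼t (subst (zerosOnes m (n1 w) ⊆_) (sym t≡)
      (++⁺ (replicate-⊆ b0 m≤lead) ones⊆r))
  where
  n1≡ : n1 w ≡ n1 r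
  n1≡ = trans (∼-count b1 w∼t) (trans (cong n1 t≡)
          (trans (count-++ b1 (replicate (lead0 t) b0) r) (cong (_+ n1 r) (count-b1-zeros (lead0 t)))))
  ones⊆r : replicate (n1 w) b1 ⊆ r
  ones⊆r = subst (λ k → replicate k b1 ⊆ r) (sym n1≡) (replicate-count-⊆ b1 r)

zerosOnes-subword⇒ : ∀ {m} w → IsSubword (zerosOnes m (n1 w)) w → m ≤ longest0 w
zerosOnes-subword⇒ {m} w sub with IsSubword⇒⊆∼ sub
... | t , w∼t , p with ++-⊆-split (replicate m b0) (replicate (n1 w) b1) p
... | T₁ , T₂ , refl , p₁ , p₂ = begin
  m                         ≡⟨ sym (length-replicate m) ⟩
  length (replicate m b0)   ≤⟨ length-mono-≤ p₁ ⟩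
  length T₁                 ≤⟨ length-≤-lead0 T₁ T₂ T₁-has-no-ones ⟩
  lead0 (T₁ ++ T₂)          ≤⟨ lead0-∼-≤-longest0 w∼t ⟩
  longest0 w                ∎
  where
  open ≤-Reasoning
  n1≤ : n1 w ≤ n1 T₂
  n1≤ = subst (_≤ n1 T₂) (count-replicate b1 (n1 w)) (count-mono-⊆ b1 p₂)
  n1≡ : n1 w ≡ n1 T₁ + n1 T₂
  n1≡ = trans (∼-count b1 w∼t) (count-++ b1 T₁ T₂)
  T₁-has-no-ones : n1 T₁ ≡ 0
  T₁-has-no-ones = n≤0⇒n≡0 (+-cancelʳ-≤ (n1 T₂) (n1 T₁) 0 (subst (_≤ n1 T₂) n1≡ n1≤))

zerosOne-⊆ : ∀ {q t} → zerosOne q ⊆ t → ∃₂ λ P Q → t ≡ P ++ b1 ∷ Q × q ≤ n0 P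
zerosOne-⊆ {q} p with ++-⊆-split (replicate q b0) (b1 ∷ []) p
... | t₁ , t₂ , refl , p₁ , p₂ with ∷-⊆-split b1 [] p₂
... | P , Q , refl , _ =
  t₁ ++ P , Q , sym (++-assoc t₁ P (b1 ∷ Q)) ,
  ≤-trans q≤t₁ (subst (n0 t₁ ≤_) (sym (count-++ b0 t₁ P)) (m≤m+n _ _))
  where
  q≤t₁ : q ≤ n0 t₁
  q≤t₁ = subst (_≤ n0 t₁) (count-replicate b0 q) (count-mono-⊆ b0 p₁)

twoBlocks-subword⇒ : ∀ {q} w → IsSubword (twoBlocks q) w → q + longest0 w ≤ n0 w
twoBlocks-subword⇒ {q} w sub with IsSubword⇒⊆∼ sub
... | t , w∼t , p with ++-⊆-split (zerosOne q) (zerosOne q) p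
... | t₁ , t₂ , refl , p₁ , p₂ with zerosOne-⊆ p₁ | zerosOne-⊆ p₂
... | P₁ , Q₁ , refl , q≤P₁ | P₂ , Q₂ , refl , q≤P₂ with longest0-witness w ≤-refl
... | z , w∼z , x≤lead =
  subst (q + longest0 w ≤_) (sym n0≡)
    ([ in-Y , in-X ]′ (lead0-∼-two-ones Y X (∼-trans (∼-sym w∼cut) w∼z)))
  where
  Y = Q₁ ++ P₂
  X = Q₂ ++ P₁
  w∼cut : w ∼ b1 ∷ Y ++ b1 ∷ X
  w∼cut = ∼-trans w∼t (∼-two-cuts P₁ Q₁ P₂ Q₂ b1 b1)
  n0≡ : n0 w ≡ n0 Y + n0 X
  n0≡ = trans (∼-count b0 w∼cut) (count-++ b0 Y (b1 ∷ X))
  q≤Y : q ≤ n0 Y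
  q≤Y = ≤-trans q≤P₂ (count-suffix-≤ b0 Q₁ P₂)
  q≤X : q ≤ n0 X
  q≤X = ≤-trans q≤P₁ (count-suffix-≤ b0 Q₂ P₁)
  in-Y : lead0 z ≤ n0 Y → q + longest0 w ≤ n0 Y + n0 X
  in-Y le = subst (q + longest0 w ≤_) (+-comm (n0 X) (n0 Y)) (+-mono-≤ q≤X (≤-trans x≤lead le))
  in-X : lead0 z ≤ n0 X → q + longest0 w ≤ n0 Y + n0 X
  in-X le = +-mono-≤ q≤Y (≤-trans x≤lead le)

twoBlocks-subword : ∀ {q} w → q ≤ longest0 w → q + longest0 w ≤ n0 w → longest0 w < n0 w →
                    IsSubword (twoBlocks q) w
twoBlocks-subword {q} w q≤x q+x≤n0 x<n0 with longest-block-rotation w x<n0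
... | p , w∼ = ⊆∼⇒IsSubword w∼
  (subst (twoBlocks q ⊆_) (++-assoc (replicate x b0) (b1 ∷ []) (p ++ b1 ∷ []))
         (++⁺ (++⁺ (replicate-⊆ b0 q≤x) ⊆-refl) (++⁺ q⊆p ⊆-refl)))
  where
  x = longest0 w
  n0≡ : n0 w ≡ n0 p + x
  n0≡ = trans (∼-count b0 w∼) (trans (count-++ b0 (replicate x b0) _) (trans
          (cong₂ _+_ (count-replicate b0 x) (trans (count-++ b0 p (b1 ∷ [])) (+-identityʳ _)))
          (+-comm x (n0 p))))
  q⊆p : replicate q b0 ⊆ p
  q⊆p = ⊆-trans (replicate-⊆ b0 (+-cancelʳ-≤ x q (n0 p) (subst (q + x ≤_) n0≡ q+x≤n0)))
                (replicate-count-⊆ b0 p)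

zerosOnes-short : ∀ {N0 N1 x y} → N1 ≤ N0 → y < x → y + x ≤ N0 →
                  4 * (suc y + N1) ≤ 3 * (N0 + N1) + 16
zerosOnes-short {N0} {N1} {x} {y} N1≤N0 y<x y+x≤N0 = begin
  4 * (suc y + N1)                    ≡⟨ solve (y ∷ N1 ∷ []) ⟩
  2 * (y + suc y) + (N1 + 3 * N1) + 2
    ≤⟨ +-monoˡ-≤ 2 (+-mono-≤ (*-monoʳ-≤ 2 y+y+1≤N0) (+-monoˡ-≤ (3 * N1) N1≤N0)) ⟩
  2 * N0 + (N0 + 3 * N1) + 2          ≡⟨ solve (N0 ∷ N1 ∷ []) ⟩
  3 * (N0 + N1) + 2                   ≤⟨ +-monoʳ-≤ (3 * (N0 + N1)) (s≤s (s≤s z≤n)) ⟩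
  3 * (N0 + N1) + 16                  ∎
  where
  open ≤-Reasoning
  y+y+1≤N0 : y + suc y ≤ N0
  y+y+1≤N0 = ≤-trans (+-monoʳ-≤ y y<x) y+x≤N0

twoBlocks-short : ∀ {N0 N1 y q} → q + y ≤ N0 → 3 * (N0 + N1) + 16 < 4 * (suc y + N1) →
                  4 * (2 * (q + 1)) ≤ 3 * (N0 + N1) + 16
twoBlocks-short {N0} {N1} {y} {q} q+y≤N0 long =
  +-cancelʳ-≤ (2 * suc (3 * (N0 + N1) + 16)) _ _ (begin
    4 * (2 * (q + 1)) + 2 * suc (3 * (N0 + N1) + 16)
      ≤⟨ +-monoʳ-≤ (4 * (2 * (q + 1))) (*-monoʳ-≤ 2 long) ⟩
    4 * (2 * (q + 1)) + 2 * (4 * (suc y + N1))      ≡⟨ solve (q ∷ y ∷ N1 ∷ []) ⟩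
    8 * (q + y) + 8 * N1 + 16
      ≤⟨ +-monoˡ-≤ 16 (+-monoˡ-≤ (8 * N1) (*-monoʳ-≤ 8 q+y≤N0)) ⟩
    8 * N0 + 8 * N1 + 16                            ≤⟨ m≤m+n _ (N0 + N1 + 34) ⟩
    8 * N0 + 8 * N1 + 16 + (N0 + N1 + 34)           ≡⟨ solve (N0 ∷ N1 ∷ []) ⟩
    3 * (N0 + N1) + 16 + 2 * suc (3 * (N0 + N1) + 16) ∎)
  where open ≤-Reasoning

distinguishing-subword : ∀ u v → n0 u ≡ n0 v → n1 u ≡ n1 v → n1 u ≤ n0 u →
                         longest0 v < longest0 u →
                         ∃ λ s → Distinguishing s u v × 4 * length s ≤ 3 * length u + 16
distinguishing-subword u v n0≡ n1≡ n1≤n0 y<x =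
  choose (4 * (suc y + N1) ≤? 3 * (N0 + N1) + 16) (q ≤? y)
  where
  x = longest0 u
  y = longest0 v
  N0 = n0 u
  N1 = n1 u
  q = suc N0 ∸ x
  x≤N0 : x ≤ N0
  x≤N0 = longest0-≤-n0 u
  q+x≡ : q + x ≡ suc N0
  q+x≡ = m∸n+n≡m (≤-trans x≤N0 (n≤1+n N0))
  q+y≤N0 : q + y ≤ N0
  q+y≤N0 = ≤-pred (subst (q + y <_) q+x≡ (+-monoʳ-< q y<x))
  Goal : Set
  Goal = ∃ λ s → Distinguishing s u v × 4 * length s ≤ 3 * length u + 16
  fits : ∀ s {ℓ} → length s ≡ ℓ → 4 * ℓ ≤ 3 * (N0 + N1) + 16 →
         4 * length s ≤ 3 * length u + 16
  fits s |s|≡ℓ = subst₂ (λ a b → 4 * a ≤ 3 * b + 16) (sym |s|≡ℓ) (sym (length≡n0+n1 u))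
  zerosOnes-witness : 4 * (suc y + N1) ≤ 3 * (N0 + N1) + 16 → Goal
  zerosOnes-witness short =
    zerosOnes (suc y) N1 ,
    inj₁ (zerosOnes-subword u y<x ,
          <-irrefl refl ∘ zerosOnes-subword⇒ v
                        ∘ subst (λ k → IsSubword (zerosOnes (suc y) k) v) n1≡) ,
    fits (zerosOnes (suc y) N1) (length-zerosOnes (suc y) N1) short
  twoBlocks-witness : q ≤ y → 4 * (2 * (q + 1)) ≤ 3 * (N0 + N1) + 16 → Goal
  twoBlocks-witness q≤y short =
    twoBlocks q ,
    inj₂ (twoBlocks-subword v q≤y (subst (q + y ≤_) n0≡ q+y≤N0)
                                  (subst (y <_) n0≡ (<-≤-trans y<x x≤N0)) ,
          1+n≰n ∘ subst (_≤ N0) q+x≡ ∘ twoBlocks-subword⇒ u) ,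
    fits (twoBlocks q) (length-twoBlocks q) short
  choose : Dec (4 * (suc y + N1) ≤ 3 * (N0 + N1) + 16) → Dec (q ≤ y) → Goal
  choose (yes short) _ = zerosOnes-witness short
  choose (no long) (yes q≤y) = twoBlocks-witness q≤y (twoBlocks-short q+y≤N0 (≰⇒> long))
  choose (no _) (no q≰y) = zerosOnes-witness (zerosOnes-short n1≤n0 y<x y+x≤N0)
    where
    y+x≤N0 : y + x ≤ N0
    y+x≤N0 = ≤-pred (subst (y + x <_) q+x≡ (+-monoˡ-< x (≰⇒> q≰y)))

lemma1 : (n : ℕ) (u v : Word) → length u ≡ n → length v ≡ n → ¬ Conj u v
       → n0 u ≡ n0 v → n1 u ≡ n1 v → blocks0 u ≡ blocks0 v → n0 u ≥ n1 u
       → longest0 u ≢ longest0 v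
       → ∃ λ s → Distinguishing s u v × 4 * length s ≤ 3 * n + 16
lemma1 n u v |u|≡n |v|≡n _ n0≡ n1≡ _ n1≤n0 x≢y = by-cases (<-cmp (longest0 v) (longest0 u))
  where
  Goal : Set
  Goal = ∃ λ s → Distinguishing s u v × 4 * length s ≤ 3 * n + 16
  at-length : ∀ w → length w ≡ n →
              (∃ λ s → Distinguishing s u v × 4 * length s ≤ 3 * length w + 16) → Goal
  at-length w = subst (λ m → ∃ λ s → Distinguishing s u v × 4 * length s ≤ 3 * m + 16)
  by-cases : Tri (longest0 v < longest0 u) (longest0 v ≡ longest0 u) (longest0 u < longest0 v) → Goal
  by-cases (tri< y<x _ _) = at-length u |u|≡n (distinguishing-subword u v n0≡ n1≡ n1≤n0 y<x)
  by-cases (tri≈ _ y≡x _) = ⊥-elim (x≢y (sym y≡x))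
  by-cases (tri> _ _ x<y) = at-length v |v|≡n (map₂ (map₁ swap)
    (distinguishing-subword v u (sym n0≡) (sym n1≡) (subst₂ _≤_ n1≡ n0≡ n1≤n0) x<y))
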